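{- Let $\varphi_1,\varphi_2$ be CNFs and $B_1,B_2$ OBDDs with $\varphi_1\unlhd B_1$ and $\varphi_2\unlhd B_2$. Then the conjunction algorithm returns an OBDD $B_1\wedge B_2$ with $\varphi_1\wedge\varphi_2\unlhd B_1\wedge B_2$.
   Context: A literal is a variable or its negation, a clause a disjunction of literals, a CNF a conjunction of clauses; $\mathsf{Cls}(\varphi)$ is the set of clauses of $\varphi$. An OBDD is a directed acyclic graph with a unique root, in which every inner node $p$ is labelled by a variable $\mathsf{var}(p)$ and has a true-successor and a false-successor, every leaf is labelled $\mathsf{true}$ or $\mathsf{false}$, and there is a fixed total order $\prec$ of variables (common to all OBDDs considered) such that along every edge between inner nodes labelled $x$ then $y$ we have $x\prec y$. A path of $B$ is the sequence of literals $l_1\dots l_k$ read along a walk from the root to a leaf through inner nodes $p_1,\dots,p_k$, with $l_i=\mathsf{var}(p_i)$ if the walk goes to the true-successor of $p_i$ and $l_i=\lnot\mathsf{var}(p_i)$ otherwise; $\mathsf{Path^f}(B)$ is the set of paths ending in the $\mathsf{false}$ leaf. For a path $\alpha$ (viewed as a conjunction of literals) and a clause $C$, $\alpha\not\models C$ means every truth assignment satisfying all literals of $\alpha$ falsifies $C$. $\varphi\unlhd B$ means: for every truth assignment $A$, $A$ falsifies $\varphi$ if and only if $A$ satisfies all literals of some $\alpha\in\mathsf{Path^f}(B)$; and for every $\alpha\in\mathsf{Path^f}(B)$ there is $C\in\mathsf{Cls}(\varphi)$ with $\alpha\not\models C$. Conjunction $B_1\wedge B_2$ is computed recursively: if $B_1$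 or $B_2$ is the $\mathsf{false}$ leaf return $\mathsf{false}$; if $B_1$ is $\mathsf{true}$ return $B_2$; if $B_2$ is $\mathsf{true}$ return $B_1$; otherwise let $x,y$ be the root variables; if $x=y$ return a node labelled $x$ with true-child $\mathsf{high}(B_1)\wedge\mathsf{high}(B_2)$ and false-child $\mathsf{low}(B_1)\wedge\mathsf{low}(B_2)$; if $x\prec y$ return a node labelled $x$ with children $\mathsf{high}(B_1)\wedge B_2$, $\mathsf{low}(B_1)\wedge B_2$; if $y\prec x$ symmetrically. Here $\mathsf{high},\mathsf{low}$ denote sub-OBDDs rooted at the true-/false-successor of the root. Existing identical nodes are reused; no elimination is performed. -}

module Defs where

open import Data.Nat using (ℕ; _<_)
open import Data.Nat.Properties using (<-cmp)
open import Data.Bool using (Bool; true; false; not)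
open import Data.List using (List; []; _∷_; _++_)
open import Data.List.Relation.Unary.All using (All)
open import Data.List.Relation.Unary.Any using (Any)
open import Data.List.Membership.Propositional using (_∈_)
open import Data.Product using (Σ; _×_; ∃-syntax)
open import Data.Unit using (⊤)
open import Relation.Binary.PropositionalEquality using (_≡_)
open import Relation.Binary using (Tri; tri<; tri≈; tri>)

-- Variables are natural numbers; the fixed total variable order ≺ is _<_ on ℕ.
Var : Set
Var = ℕ

data Literal : Set where
  pos : Var → Literal
  neg : Var → Literal

Clause : Set
Clause = List Literal

CNF : Set
CNF = List Clause

_∧ᶜ_ : CNF → CNF → CNF
φ ∧ᶜ ψ = φ ++ ψ

Assignment : Set
Assignment = Var → Bool

evalLit : Assignment → Literal → Bool
evalLit A (pos x) = A x
evalLit A (neg x) = not (A x)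

SatLit : Assignment → Literal → Set
SatLit A l = evalLit A l ≡ true

FalsLit : Assignment → Literal → Set
FalsLit A l = evalLit A l ≡ false

FalsifiesClause : Assignment → Clause → Set
FalsifiesClause A C = All (FalsLit A) C

FalsifiesCNF : Assignment → CNF → Set
FalsifiesCNF A φ = Any (FalsifiesClause A) φ

SatPath : Assignment → List Literal → Set
SatPath A α = All (SatLit A) α

_⊭_ : List Literal → Clause → Set
α ⊭ C = (A : Assignment) → SatPath A α → FalsifiesClause A C

-- OBDDs, represented by their unfolding into a decision tree
-- (sharing of identical nodes does not affect paths or semantics).
data OBDD : Set where
  leaf : Bool → OBDD
  node : Var → (high low : OBDD) → OBDD

Above : Var → OBDD → Set
Above x (leaf _)     = ⊤
Above x (node y _ _) = x < y

Ordered : OBDD → Set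
Ordered (leaf _)     = ⊤
Ordered (node x h l) = Above x h × Above x l × Ordered h × Ordered l

data FalsePath : OBDD → List Literal → Set where
  here : FalsePath (leaf false) []
  hi   : ∀ {x h l α} → FalsePath h α → FalsePath (node x h l) (pos x ∷ α)
  lo   : ∀ {x h l α} → FalsePath l α → FalsePath (node x h l) (neg x ∷ α)

_⊴_ : CNF → OBDD → Set
φ ⊴ B =
  ((A : Assignment) →
     (FalsifiesCNF A φ → ∃[ α ] (FalsePath B α × SatPath A α))
   × (∃[ α ] (FalsePath B α × SatPath A α) → FalsifiesCNF A φ))
  × ((α : List Literal) → FalsePath B α → ∃[ C ] (C ∈ φ × α ⊭ C))

-- The conjunction algorithm, exactly the recursion of the paper; written
-- with an inner recursion on B₂ (go) so that termination is structural.
_∧ᴮ_ : OBDD → OBDD → OBDD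
leaf false   ∧ᴮ B₂ = leaf false
leaf true    ∧ᴮ B₂ = B₂
node x h₁ l₁ ∧ᴮ B₂ = go B₂
  where
  go : OBDD → OBDD
  go (leaf false) = leaf false
  go (leaf true)  = node x h₁ l₁
  go (node y h₂ l₂) with <-cmp x y
  ... | tri< _ _ _ = node x (h₁ ∧ᴮ node y h₂ l₂) (l₁ ∧ᴮ node y h₂ l₂)
  ... | tri≈ _ _ _ = node x (h₁ ∧ᴮ h₂) (l₁ ∧ᴮ l₂)
  ... | tri> _ _ _ = node y (go h₂) (go l₂)

-- An assignment A satisfies a false path of B exactly when the decision
-- tree B evaluates to false at A, and the conjunction algorithm satisfies
-- eval (B₁ ∧ᴮ B₂) A = eval B₁ A ∧ eval B₂ A; this gives the semantic half
-- of φ₁ ∧ φ₂ ⊴ B₁ ∧ᴮ B₂. For the clause half, every false path of B₁ ∧ᴮ B₂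
-- is a false path of B₁ or of B₂ with extra literals interleaved, so it
-- entails that path, and the clause refuted by the shorter path is refuted
-- by the longer one.
module Submission where

open import Data.Bool using (Bool; true; false; not; _∧_; if_then_else_)
open import Data.Bool.Properties using (∧-zeroʳ; ∧-identityʳ; not-injective)
open import Data.List using (List; []; _∷_)
open import Data.List.Membership.Propositional using (_∈_)
open import Data.List.Relation.Binary.Subset.Propositional using (_⊆_)
open import Data.List.Membership.Propositional.Properties using (∈-++⁺ˡ; ∈-++⁺ʳ)
open import Data.List.Relation.Unary.All using ([]; _∷_)
open import Data.List.Relation.Unary.Any.Properties using (++↔)
open import Data.Nat using (_<_)
open import Data.Nat.Properties using (<-cmp)
open import Data.Product using (_×_; _,_; uncurry; ∃-syntax)
open import Data.Sum as Sum using (_⊎_; inj₁; inj₂; [_,_])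
open import Data.Sum.Function.Propositional using (_⊎-⇔_)
open import Data.Unit using (tt)
open import Function.Bundles using (_⇔_; mk⇔; Equivalence)
import Function.Properties.Equivalence as ⇔
open import Function.Properties.Inverse using (↔⇒⇔)
import Function.Related.Propositional as Related
open import Relation.Binary using (tri<; tri≈; tri>)
open import Relation.Binary.PropositionalEquality using (_≡_; refl; sym; cong)

open import Defs

-- The graph of _∧ᴮ_: induction on it replaces, in every lemma below, the
-- <-cmp split and the nested recursion through which _∧ᴮ_ is defined.
data Conj : OBDD → OBDD → OBDD → Set where
  false∧  : ∀ {B} → Conj (leaf false) B (leaf false)
  true∧   : ∀ {B} → Conj (leaf true) B B
  ∧false  : ∀ {x h l} → Conj (node x h l) (leaf false) (leaf false)
  ∧true   : ∀ {x h l} → Conj (node x h l) (leaf true) (node x h l)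
  node<   : ∀ {x h₁ l₁ y h₂ l₂ H L} → x < y →
            Conj h₁ (node y h₂ l₂) H → Conj l₁ (node y h₂ l₂) L →
            Conj (node x h₁ l₁) (node y h₂ l₂) (node x H L)
  node≈   : ∀ {x h₁ l₁ h₂ l₂ H L} →
            Conj h₁ h₂ H → Conj l₁ l₂ L →
            Conj (node x h₁ l₁) (node x h₂ l₂) (node x H L)
  node>   : ∀ {x h₁ l₁ y h₂ l₂ H L} → y < x →
            Conj (node x h₁ l₁) h₂ H → Conj (node x h₁ l₁) l₂ L →
            Conj (node x h₁ l₁) (node y h₂ l₂) (node y H L)

conj-∧ᴮ : ∀ B₁ B₂ → Conj B₁ B₂ (B₁ ∧ᴮ B₂)
conj-∧ᴮ (leaf false)   _  = false∧
conj-∧ᴮ (leaf true)    _  = true∧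
conj-∧ᴮ (node x h₁ l₁) B₂ = conj-node B₂
  where
  conj-node : ∀ B₂ → Conj (node x h₁ l₁) B₂ (node x h₁ l₁ ∧ᴮ B₂)
  conj-node (leaf false)   = ∧false
  conj-node (leaf true)    = ∧true
  conj-node (node y h₂ l₂) with <-cmp x y
  ... | tri< x<y _ _ = node< x<y (conj-∧ᴮ h₁ (node y h₂ l₂)) (conj-∧ᴮ l₁ (node y h₂ l₂))
  ... | tri≈ _ refl _ = node≈ (conj-∧ᴮ h₁ h₂) (conj-∧ᴮ l₁ l₂)
  ... | tri> _ _ y<x = node> y<x (conj-node h₂) (conj-node l₂)

above-conj : ∀ {z B₁ B₂ B} → Conj B₁ B₂ B → Above z B₁ → Above z B₂ → Above z B
above-conj false∧         _   _   = tt
above-conj true∧          _   z<₂ = z<₂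
above-conj ∧false         _   _   = tt
above-conj ∧true          z<₁ _   = z<₁
above-conj (node< _ _ _)  z<₁ _   = z<₁
above-conj (node≈ _ _)    z<₁ _   = z<₁
above-conj (node> _ _ _)  _   z<₂ = z<₂

ordered-conj : ∀ {B₁ B₂ B} → Conj B₁ B₂ B → Ordered B₁ → Ordered B₂ → Ordered B
ordered-conj false∧ _  _  = tt
ordered-conj true∧  _  o₂ = o₂
ordered-conj ∧false _  _  = tt
ordered-conj ∧true  o₁ _  = o₁
ordered-conj (node< x<y cʰ cˡ) (x<h₁ , x<l₁ , oh₁ , ol₁) o₂ =
  above-conj cʰ x<h₁ x<y , above-conj cˡ x<l₁ x<y ,
  ordered-conj cʰ oh₁ o₂ , ordered-conj cˡ ol₁ o₂
ordered-conj (node≈ cʰ cˡ) (x<h₁ , x<l₁ , oh₁ , ol₁) (x<h₂ , x<l₂ , oh₂ , ol₂) =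
  above-conj cʰ x<h₁ x<h₂ , above-conj cˡ x<l₁ x<l₂ ,
  ordered-conj cʰ oh₁ oh₂ , ordered-conj cˡ ol₁ ol₂
ordered-conj (node> y<x cʰ cˡ) o₁ (y<h₂ , y<l₂ , oh₂ , ol₂) =
  above-conj cʰ y<x y<h₂ , above-conj cˡ y<x y<l₂ ,
  ordered-conj cʰ o₁ oh₂ , ordered-conj cˡ o₁ ol₂

eval : OBDD → Assignment → Bool
eval (leaf b)     A = b
eval (node x h l) A = if A x then eval h A else eval l A

eval-conj : ∀ {B₁ B₂ B} → Conj B₁ B₂ B → ∀ A → eval B A ≡ eval B₁ A ∧ eval B₂ A
eval-conj false∧ A = refl
eval-conj true∧  A = refl
eval-conj {B₁} ∧false A = sym (∧-zeroʳ (eval B₁ A))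
eval-conj {B₁} ∧true  A = sym (∧-identityʳ (eval B₁ A))
eval-conj (node< {x = x} _ cʰ cˡ) A with A x
... | true  = eval-conj cʰ A
... | false = eval-conj cˡ A
eval-conj (node≈ {x = x} cʰ cˡ) A with A x
... | true  = eval-conj cʰ A
... | false = eval-conj cˡ A
eval-conj (node> {y = y} _ cʰ cˡ) A with A y
... | true  = eval-conj cʰ A
... | false = eval-conj cˡ A

FalseAt : OBDD → Assignment → Set
FalseAt B A = ∃[ α ] (FalsePath B α × SatPath A α)

falseAt⇒eval≡false : ∀ {B α A} → FalsePath B α → SatPath A α → eval B A ≡ false
falseAt⇒eval≡false here   []             = refl
falseAt⇒eval≡false (hi p) (Ax≡true  ∷ s) rewrite Ax≡true = falseAt⇒eval≡false p s
falseAt⇒eval≡false (lo p) (¬Ax≡true ∷ s) rewrite not-injective ¬Ax≡true =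
  falseAt⇒eval≡false p s

eval≡false⇒falseAt : ∀ B A → eval B A ≡ false → FalseAt B A
eval≡false⇒falseAt (leaf false) A refl = [] , here , []
eval≡false⇒falseAt (node x h l) A e with A x in Ax
... | true  with eval≡false⇒falseAt h A e
...   | α , p , s = pos x ∷ α , hi p , Ax ∷ s
eval≡false⇒falseAt (node x h l) A e | false with eval≡false⇒falseAt l A e
...   | α , p , s = neg x ∷ α , lo p , cong not Ax ∷ s

falseAt⇔eval≡false : ∀ B A → FalseAt B A ⇔ (eval B A ≡ false)
falseAt⇔eval≡false B A =
  mk⇔ (λ (_ , p , s) → falseAt⇒eval≡false p s) (eval≡false⇒falseAt B A)

∧≡false⇔ : ∀ b c → (b ∧ c ≡ false) ⇔ (b ≡ false ⊎ c ≡ false)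
∧≡false⇔ b c = mk⇔ (to b) [ (λ { refl → refl }) , (λ { refl → ∧-zeroʳ b }) ]
  where
  to : ∀ b → b ∧ c ≡ false → b ≡ false ⊎ c ≡ false
  to false _       = inj₁ refl
  to true  c≡false = inj₂ c≡false

falseAt-conj : ∀ {B₁ B₂ B} → Conj B₁ B₂ B → ∀ A →
               FalseAt B A ⇔ (FalseAt B₁ A ⊎ FalseAt B₂ A)
falseAt-conj {B₁} {B₂} {B} c A = begin
  FalseAt B A                              ∼⟨ falseAt⇔eval≡false B A ⟩
  eval B A ≡ false                         ≡⟨ cong (_≡ false) (eval-conj c A) ⟩
  eval B₁ A ∧ eval B₂ A ≡ false            ∼⟨ ∧≡false⇔ (eval B₁ A) (eval B₂ A) ⟩
  (eval B₁ A ≡ false ⊎ eval B₂ A ≡ false)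
    ∼⟨ ⇔.sym (falseAt⇔eval≡false B₁ A ⊎-⇔ falseAt⇔eval≡false B₂ A) ⟩
  (FalseAt B₁ A ⊎ FalseAt B₂ A)            ∎
  where open Related.EquationalReasoning

_⊨ᵖ_ : List Literal → List Literal → Set
α ⊨ᵖ β = (A : Assignment) → SatPath A α → SatPath A β

EntailsFalsePath : OBDD → List Literal → Set
EntailsFalsePath B α = ∃[ β ] (FalsePath B β × α ⊨ᵖ β)

entailsFalsePath-refl : ∀ {B α} → FalsePath B α → EntailsFalsePath B α
entailsFalsePath-refl p = _ , p , λ _ s → s

entailsFalsePath-hi : ∀ {x h l α} →
                      EntailsFalsePath h α → EntailsFalsePath (node x h l) (pos x ∷ α)
entailsFalsePath-hi (β , p , α⊨β) = pos _ ∷ β , hi p , λ { A (a ∷ s) → a ∷ α⊨β A s }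

entailsFalsePath-lo : ∀ {x h l α} →
                      EntailsFalsePath l α → EntailsFalsePath (node x h l) (neg x ∷ α)
entailsFalsePath-lo (β , p , α⊨β) = neg _ ∷ β , lo p , λ { A (a ∷ s) → a ∷ α⊨β A s }

entailsFalsePath-∷ : ∀ {B l α} → EntailsFalsePath B α → EntailsFalsePath B (l ∷ α)
entailsFalsePath-∷ (β , p , α⊨β) = β , p , λ { A (_ ∷ s) → α⊨β A s }

falsePath-conj : ∀ {B₁ B₂ B α} → Conj B₁ B₂ B → FalsePath B α →
                 EntailsFalsePath B₁ α ⊎ EntailsFalsePath B₂ α
falsePath-conj false∧ p = inj₁ (entailsFalsePath-refl p)
falsePath-conj true∧  p = inj₂ (entailsFalsePath-refl p)
falsePath-conj ∧false p = inj₂ (entailsFalsePath-refl p)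
falsePath-conj ∧true  p = inj₁ (entailsFalsePath-refl p)
falsePath-conj (node< _ cʰ _) (hi p) =
  Sum.map entailsFalsePath-hi entailsFalsePath-∷ (falsePath-conj cʰ p)
falsePath-conj (node< _ _ cˡ) (lo p) =
  Sum.map entailsFalsePath-lo entailsFalsePath-∷ (falsePath-conj cˡ p)
falsePath-conj (node≈ cʰ _) (hi p) =
  Sum.map entailsFalsePath-hi entailsFalsePath-hi (falsePath-conj cʰ p)
falsePath-conj (node≈ _ cˡ) (lo p) =
  Sum.map entailsFalsePath-lo entailsFalsePath-lo (falsePath-conj cˡ p)
falsePath-conj (node> _ cʰ _) (hi p) =
  Sum.map entailsFalsePath-∷ entailsFalsePath-hi (falsePath-conj cʰ p)
falsePath-conj (node> _ _ cˡ) (lo p) =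
  Sum.map entailsFalsePath-∷ entailsFalsePath-lo (falsePath-conj cˡ p)

RefutesClauseOf : List Literal → CNF → Set
RefutesClauseOf α φ = ∃[ C ] (C ∈ φ × α ⊭ C)

entailsFalsePath⇒refutesClause : ∀ {B φ ψ α} → φ ⊆ ψ →
  (∀ β → FalsePath B β → RefutesClauseOf β φ) →
  EntailsFalsePath B α → RefutesClauseOf α ψ
entailsFalsePath⇒refutesClause φ⊆ψ refutes (β , p , α⊨β) with refutes β p
... | C , C∈φ , β⊭C = C , φ⊆ψ C∈φ , λ A s → β⊭C A (α⊨β A s)

corollary1 : (φ₁ φ₂ : CNF) (B₁ B₂ : OBDD) →
    Ordered B₁ → Ordered B₂ → φ₁ ⊴ B₁ → φ₂ ⊴ B₂ →
    Ordered (B₁ ∧ᴮ B₂) × ((φ₁ ∧ᶜ φ₂) ⊴ (B₁ ∧ᴮ B₂))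
corollary1 φ₁ φ₂ B₁ B₂ o₁ o₂ (sem₁ , cls₁) (sem₂ , cls₂) =
  ordered-conj c o₁ o₂ , (λ A → Equivalence.to (sem A) , Equivalence.from (sem A)) , cls
  where
  c : Conj B₁ B₂ (B₁ ∧ᴮ B₂)
  c = conj-∧ᴮ B₁ B₂

  sem : ∀ A → FalsifiesCNF A (φ₁ ∧ᶜ φ₂) ⇔ FalseAt (B₁ ∧ᴮ B₂) A
  sem A = begin
    FalsifiesCNF A (φ₁ ∧ᶜ φ₂)                ∼⟨ ⇔.sym (↔⇒⇔ ++↔) ⟩
    (FalsifiesCNF A φ₁ ⊎ FalsifiesCNF A φ₂)  ∼⟨ uncurry mk⇔ (sem₁ A) ⊎-⇔ uncurry mk⇔ (sem₂ A) ⟩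
    (FalseAt B₁ A ⊎ FalseAt B₂ A)            ∼⟨ ⇔.sym (falseAt-conj c A) ⟩
    FalseAt (B₁ ∧ᴮ B₂) A                     ∎
    where open Related.EquationalReasoning

  cls : ∀ α → FalsePath (B₁ ∧ᴮ B₂) α → RefutesClauseOf α (φ₁ ∧ᶜ φ₂)
  cls α p = [ entailsFalsePath⇒refutesClause ∈-++⁺ˡ cls₁
            , entailsFalsePath⇒refutesClause (∈-++⁺ʳ φ₁) cls₂
            ] (falsePath-conj c p)
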